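{- Let $X$ be a finite simplicial complex with subcomplexes $A,B$, $A\cup B=X$, and let $\widetilde X=\bar A\cup\mathbb P(\overline{A\cap B})\cup\bar B$ and the discrete vector field $\mathcal V$ on $\widetilde X$ be as described in the context. Then $\mathcal V$ is a gradient vector field on $\widetilde X$.
   Context: Label the vertices of $A$ as $a_0,\dots,a_n$ and of $B$ as $b_0,\dots,b_p$ so that the vertices of $A\cap B$ are $c_i=a_i=b_i$, $0\le i\le m$. $\bar A$ (vertices $\bar a_i$) and $\bar B$ (vertices $\bar b_i$) are vertex-disjoint copies of $A$ and $B$; a simplex $\sigma$ of $A$ (resp. $B$) has copy $\sigma_{\bar A}$ (resp. $\sigma_{\bar B}$). $\mathbb P(\overline{A\cap B})$ is the simplicial complex on vertices $\{\bar a_i,\bar b_i:0\le i\le m\}$ whose simplices are all subsets of the sets $\{\bar a_{i_0},\dots,\bar a_{i_r},\bar b_{i_r},\dots,\bar b_{i_q}\}$ with $i_0<\dots<i_q$, $\{c_{i_0},\dots,c_{i_q}\}$ a simplex of $A\cap B$, $0\le r\le q$. $\widetilde X=\bar A\cup\mathbb P(\overline{A\cap B})\cup\bar B$ (a simplicial complex). For each simplex $\{c_{i_0},\dots,c_{i_q}\}$ ($i_0<\dots<i_q$) of $A\cap B$ and each $0\le r\le q$, $\mathcal V$ contains the pair $(\{\bar a_{i_0},\dots,\bar a_{i_{r-1}},\bar b_{i_r},\dots,\bar b_{i_q}\},\{\bar a_{i_0},\dots,\bar a_{i_r},\bar b_{i_r},\dots,\bar b_{i_q}\})$ (for $r=0$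 the first entry is $\{\bar b_{i_0},\dots,\bar b_{i_q}\}$), and $\mathcal V$ contains no other pairs. A discrete vector field is a set of pairs $(\sigma^{(q-1)},\tau^{(q)})$, $\sigma\subset\tau$, each simplex in at most one pair; it is gradient if there is no closed trajectory $\tau_0^{(q)},\sigma_1^{(q-1)},\tau_1^{(q)},\dots,\sigma_k,\tau_k=\tau_0$ ($k>1$) with $(\sigma_i,\tau_i)\in\mathcal V$, $\sigma_i\subset\tau_{i-1}$, $(\sigma_i,\tau_{i-1})\notin\mathcal V$. -}

module Defs where

open import Data.Nat using (ℕ; suc; _+_; _<_)
open import Data.Bool using (Bool; _∧_)
open import Data.Fin using (Fin; _≤_)
open import Data.Fin.Properties using (_≤?_)
open import Data.Fin.Subset using (Subset; _∈_; _⊆_; ∣_∣; Nonempty) renaming (⊥ to ∅)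
open import Data.Vec using (tabulate; lookup)
open import Data.Product using (_×_; _,_; Σ; ∃; ∃-syntax)
open import Data.Sum using (_⊎_)
open import Data.Empty using (⊥)
open import Relation.Nullary using (¬_)
open import Relation.Nullary.Decidable using (⌊_⌋)
open import Relation.Binary.PropositionalEquality using (_≡_; _≢_)

Complex : ℕ → Set₁
Complex N = Subset N → Set

IsSimplicialComplex : ∀ {N} → Complex N → Set
IsSimplicialComplex {N} K =
  (∀ σ → K σ → Nonempty σ) ×
  (∀ σ τ → K τ → σ ⊆ τ → Nonempty σ → K σ)

IsSubcomplex : ∀ {N} → Complex N → Complex N → Set
IsSubcomplex {N} A X = IsSimplicialComplex A × (∀ σ → A σ → X σ)

IsUnion : ∀ {N} → Complex N → Complex N → Complex N → Set
IsUnion {N} X A B = ∀ σ → (X σ → A σ ⊎ B σ) × (A σ ⊎ B σ → X σ)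

_∩ᶜ_ : ∀ {N} → Complex N → Complex N → Complex N
(A ∩ᶜ B) σ = A σ × B σ

-- The vertices of X̃ are copies ā_v, b̄_v of the
-- vertices v of X; a set of vertices of X̃ is encoded as a pair (S , T)
-- where S is the set of v with ā_v in it and T the set of v with b̄_v.
-- The order i₀ < … < i_q on the vertices of A ∩ B is the order of Fin N.

Simp : ℕ → Set
Simp N = Subset N × Subset N

_⊆ˢ_ : ∀ {N} → Simp N → Simp N → Set
(S , T) ⊆ˢ (S' , T') = S ⊆ S' × T ⊆ T'

NonemptyS : ∀ {N} → Simp N → Set
NonemptyS (S , T) = Nonempty S ⊎ Nonempty T

sizeS : ∀ {N} → Simp N → ℕ
sizeS (S , T) = ∣ S ∣ + ∣ T ∣

Abar : ∀ {N} → Complex N → Simp N → Set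
Abar A (S , T) = A S × T ≡ ∅

Bbar : ∀ {N} → Complex N → Simp N → Set
Bbar B (S , T) = S ≡ ∅ × B T

-- ℙ(overline{A∩B}): subsets of {ā_{i₀},…,ā_{i_r}, b̄_{i_r},…,b̄_{i_q}},
-- where ρ = {c_{i₀},…,c_{i_q}} ∈ A ∩ B and k = i_r ∈ ρ.
Pbar : ∀ {N} → Complex N → Complex N → Simp N → Set
Pbar {N} A B (S , T) =
  NonemptyS (S , T) ×
  ∃[ ρ ] ∃[ k ] ((A ∩ᶜ B) ρ × k ∈ ρ ×
     (∀ x → x ∈ S → x ∈ ρ × x ≤ k) ×
     (∀ x → x ∈ T → x ∈ ρ × k ≤ x))

Xtilde : ∀ {N} → Complex N → Complex N → Simp N → Set
Xtilde A B σ = Abar A σ ⊎ Pbar A B σ ⊎ Bbar B σ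

upTo : ∀ {N} → Subset N → Fin N → Subset N
upTo ρ k = tabulate λ x → lookup ρ x ∧ ⌊ x ≤? k ⌋

below : ∀ {N} → Subset N → Fin N → Subset N
below ρ k = tabulate λ x → lookup ρ x ∧ ⌊ suc (Data.Fin.toℕ x) Data.Nat.≤? Data.Fin.toℕ k ⌋
  where import Data.Nat

from : ∀ {N} → Subset N → Fin N → Subset N
from ρ k = tabulate λ x → lookup ρ x ∧ ⌊ k ≤? x ⌋

-- The vector field 𝒱: for ρ = {c_{i₀},…,c_{i_q}} ∈ A ∩ B and k = i_r ∈ ρ,
-- the pair ({ā_{i₀},…,ā_{i_{r-1}}, b̄_{i_r},…,b̄_{i_q}},
--           {ā_{i₀},…,ā_{i_r},     b̄_{i_r},…,b̄_{i_q}}),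
-- and no other pairs.
𝒱 : ∀ {N} → Complex N → Complex N → Simp N → Simp N → Set
𝒱 A B σ τ = ∃[ ρ ] ∃[ k ] ((A ∩ᶜ B) ρ × k ∈ ρ ×
   σ ≡ (below ρ k , from ρ k) × τ ≡ (upTo ρ k , from ρ k))

IsDiscreteVectorField : ∀ {N} → (Simp N → Set) → (Simp N → Simp N → Set) → Set
IsDiscreteVectorField K V =
  (∀ σ τ → V σ τ → K σ × K τ × σ ⊆ˢ τ × sizeS τ ≡ suc (sizeS σ)) ×
  (∀ σ τ σ' τ' → V σ τ → V σ' τ' →
     (σ ≡ σ' ⊎ σ ≡ τ' ⊎ τ ≡ σ' ⊎ τ ≡ τ') → σ ≡ σ' × τ ≡ τ')

ClosedTrajectory : ∀ {N} → (Simp N → Simp N → Set) → Set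
ClosedTrajectory {N} V =
  Σ ℕ λ k → Σ (ℕ → Simp N) λ τ → Σ (ℕ → Simp N) λ σ →
    1 < k × τ k ≡ τ 0 ×
    (∀ j → j < k →
       V (σ (suc j)) (τ (suc j)) ×
       σ (suc j) ⊆ˢ τ j ×
       ¬ V (σ (suc j)) (τ j))

IsGradientVectorField : ∀ {N} → (Simp N → Set) → (Simp N → Simp N → Set) → Set
IsGradientVectorField K V = IsDiscreteVectorField K V × ¬ ClosedTrajectory V

{-# OPTIONS --safe #-}
module Submission where

-- Each pair of 𝒱 is indexed by ρ ∈ A ∩ B and a vertex k ∈ ρ; its upper simplex has
-- b̄-part T = {x ∈ ρ | k ≤ x}, so k = min T, and its lower simplex drops ā_k.  Along a
-- 𝒱-trajectory the b̄-part T can only shrink; when it stays the same the vertex k is the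
-- same, and the ā-part S must then shrink strictly, for otherwise the step would go back
-- along the pair itself.  Hence (T , S) decreases in the lexicographic order built from
-- strict inclusion, and no trajectory closes up.  Nothing about X is used.

open import Defs
open import Data.Nat using (ℕ; zero; suc)
import Data.Nat as ℕ
import Data.Nat.Properties as ℕ
open import Data.Bool using (true; _∧_)
open import Data.Bool.Properties using (∧-conicalˡ; ∧-conicalʳ; T-≡)
open import Data.Fin using (Fin; toℕ; _≤_; _<_; _≟_)
open import Data.Fin.Properties using (_≤?_; ≤-refl; ≤-antisym; ≤∧≢⇒<; <⇒≢)
open import Data.Fin.Subset using (Subset; _∈_; _∉_; _⊆_; _⊂_; _-_; ∣_∣; inside; outside)
open import Data.Fin.Subset.Properties
  using (_∈?_; _⊂?_; ⊆-antisym; p─⊥≡p; p─q⊆p; x∈p∧x≢y⇒x∈p-y; ⊂-strictPartialOrder)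
open import Data.Vec using (_∷_; lookup; tabulate; here; there)
open import Data.Vec.Properties using (lookup∘tabulate; []=⇒lookup; lookup⇒[]=)
open import Data.Product using (_×_; _,_; ∃; proj₁; proj₂; map₁; swap)
open import Data.Product.Relation.Binary.Lex.Strict using (×-strictPartialOrder)
open import Data.Sum using (_⊎_; inj₁; inj₂)
open import Data.Empty using (⊥-elim)
open import Function using (id; _∘_; Equivalence)
open import Relation.Binary using (StrictPartialOrder)
open import Relation.Nullary using (¬_; yes; no)
open import Relation.Nullary.Decidable using (⌊_⌋; toWitness; fromWitness; decidable-stable)
open import Relation.Unary using (Pred; Decidable)
open import Relation.Binary.PropositionalEquality
  using (_≡_; _≢_; refl; sym; trans; cong; cong₂; subst; module ≡-Reasoning)
open ≡-Reasoning

module _ {n p} {P : Pred (Fin n) p} (P? : Decidable P) {ρ : Subset n} {x : Fin n} where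

  ∈-filter⁻ : x ∈ tabulate (λ y → lookup ρ y ∧ ⌊ P? y ⌋) → x ∈ ρ × P x
  ∈-filter⁻ x∈ =
    lookup⇒[]= x ρ (∧-conicalˡ _ (⌊ P? x ⌋) e) ,
    toWitness {a? = P? x} (Equivalence.from T-≡ (∧-conicalʳ (lookup ρ x) _ e))
    where
    e : lookup ρ x ∧ ⌊ P? x ⌋ ≡ true
    e = trans (sym (lookup∘tabulate _ x)) ([]=⇒lookup x∈)

  ∈-filter⁺ : x ∈ ρ → P x → x ∈ tabulate (λ y → lookup ρ y ∧ ⌊ P? y ⌋)
  ∈-filter⁺ x∈ρ Px = lookup⇒[]= x _
    (trans (lookup∘tabulate _ x) (cong₂ _∧_ ([]=⇒lookup x∈ρ) (Equivalence.to T-≡ (fromWitness Px))))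

⊆⇒⊂⊎≡ : ∀ {n} {p q : Subset n} → p ⊆ q → p ⊂ q ⊎ p ≡ q
⊆⇒⊂⊎≡ {p = p} {q} p⊆q with p ⊂? q
... | yes p⊂q = inj₁ p⊂q
... | no p⊄q = inj₂ (⊆-antisym p⊆q λ {x} x∈q →
  decidable-stable (x ∈? p) λ x∉p → p⊄q (p⊆q , x , x∈q , x∉p))

x∉p-x : ∀ {n} {p : Subset n} {x : Fin n} → x ∉ p - x
x∉p-x {p = _ ∷ _} {Fin.zero} ()
x∉p-x {p = _ ∷ _} {Fin.suc x} (there x∈p-x) = x∉p-x x∈p-x

∣p∣≡1+∣p-x∣ : ∀ {n} {p : Subset n} {x : Fin n} → x ∈ p → ∣ p ∣ ≡ suc ∣ p - x ∣
∣p∣≡1+∣p-x∣ {p = inside ∷ p} here = cong (suc ∘ ∣_∣) (sym (p─⊥≡p p))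
∣p∣≡1+∣p-x∣ {p = inside ∷ p} (there x∈p) = cong suc (∣p∣≡1+∣p-x∣ x∈p)
∣p∣≡1+∣p-x∣ {p = outside ∷ p} (there x∈p) = ∣p∣≡1+∣p-x∣ x∈p

module _ {N : ℕ} (ρ : Subset N) (k : Fin N) {x : Fin N} where

  ∈-upTo⁻ : x ∈ upTo ρ k → x ∈ ρ × x ≤ k
  ∈-upTo⁻ = ∈-filter⁻ (_≤? k)

  ∈-upTo⁺ : x ∈ ρ → x ≤ k → x ∈ upTo ρ k
  ∈-upTo⁺ = ∈-filter⁺ (_≤? k)

  ∈-below⁻ : x ∈ below ρ k → x ∈ ρ × x < k
  ∈-below⁻ = ∈-filter⁻ (λ y → suc (toℕ y) ℕ.≤? toℕ k)

  ∈-below⁺ : x ∈ ρ → x < k → x ∈ below ρ k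
  ∈-below⁺ = ∈-filter⁺ (λ y → suc (toℕ y) ℕ.≤? toℕ k)

  ∈-from⁻ : x ∈ from ρ k → x ∈ ρ × k ≤ x
  ∈-from⁻ = ∈-filter⁻ (k ≤?_)

  ∈-from⁺ : x ∈ ρ → k ≤ x → x ∈ from ρ k
  ∈-from⁺ = ∈-filter⁺ (k ≤?_)

module _ {N : ℕ} (ρ : Subset N) (k : Fin N) where

  k∈upTo : k ∈ ρ → k ∈ upTo ρ k
  k∈upTo k∈ρ = ∈-upTo⁺ ρ k k∈ρ ≤-refl

  k∈from : k ∈ ρ → k ∈ from ρ k
  k∈from k∈ρ = ∈-from⁺ ρ k k∈ρ ≤-refl

  k∉below : k ∉ below ρ k
  k∉below k∈ = ℕ.<-irrefl refl (proj₂ (∈-below⁻ ρ k k∈))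

  below⊆upTo : below ρ k ⊆ upTo ρ k
  below⊆upTo x∈ with ∈-below⁻ ρ k x∈
  ... | x∈ρ , x<k = ∈-upTo⁺ ρ k x∈ρ (ℕ.<⇒≤ x<k)

  upTo-⊆ : {p : Subset N} → k ∈ p → below ρ k ⊆ p → upTo ρ k ⊆ p
  upTo-⊆ k∈p below⊆p {x} x∈ with ∈-upTo⁻ ρ k x∈ | x ≟ k
  ... | _ , _ | yes refl = k∈p
  ... | x∈ρ , x≤k | no x≢k = below⊆p (∈-below⁺ ρ k x∈ρ (≤∧≢⇒< x≤k x≢k))

  below≡upTo-k : below ρ k ≡ upTo ρ k - k
  below≡upTo-k = ⊆-antisym
    (λ x∈ → x∈p∧x≢y⇒x∈p-y (below⊆upTo x∈) (<⇒≢ (proj₂ (∈-below⁻ ρ k x∈))))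
    (λ x∈ → let x∈ρ , x≤k = ∈-upTo⁻ ρ k (p─q⊆p _ _ x∈) in
      ∈-below⁺ ρ k x∈ρ (≤∧≢⇒< x≤k λ { refl → x∉p-x x∈ }))

  ∣upTo∣≡1+∣below∣ : k ∈ ρ → ∣ upTo ρ k ∣ ≡ suc ∣ below ρ k ∣
  ∣upTo∣≡1+∣below∣ k∈ρ = trans (∣p∣≡1+∣p-x∣ (k∈upTo k∈ρ)) (cong (suc ∘ ∣_∣) (sym below≡upTo-k))

from≡from⇒k≡k' : ∀ {N} {ρ ρ' : Subset N} {k k' : Fin N} →
  k ∈ ρ → k' ∈ ρ' → from ρ k ≡ from ρ' k' → k ≡ k'
from≡from⇒k≡k' {ρ = ρ} {ρ'} {k} {k'} k∈ρ k'∈ρ' eq = ≤-antisym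
  (proj₂ (∈-from⁻ ρ k (subst (k' ∈_) (sym eq) (k∈from ρ' k' k'∈ρ'))))
  (proj₂ (∈-from⁻ ρ' k' (subst (k ∈_) eq (k∈from ρ k k∈ρ))))

module _ {c ℓ₁ ℓ₂} (O : StrictPartialOrder c ℓ₁ ℓ₂) where
  open StrictPartialOrder O using (Carrier; module Eq)
    renaming (_<_ to _≺_; trans to ≺-trans; irrefl to ≺-irrefl)

  descending⇒¬ClosedTrajectory : ∀ {N} {V : Simp N → Simp N → Set} (φ : Simp N → Carrier) →
    (∀ {σ τ σ' τ'} → V σ τ → V σ' τ' → σ' ⊆ˢ τ → ¬ V σ' τ → φ τ' ≺ φ τ) →
    ¬ ClosedTrajectory V
  descending⇒¬ClosedTrajectory φ descends (zero , _ , _ , () , _)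
  descending⇒¬ClosedTrajectory {V = V} φ descends (suc k , τ , σ , _ , τ₁₊ₖ≡τ₀ , steps) =
    ≺-irrefl (Eq.reflexive (cong φ τ₁₊ₖ≡τ₀)) (below-τ₀ k (ℕ.n<1+n k))
    where
    isHead : ∀ j → j ℕ.< suc k → ∃ λ σ' → V σ' (τ j)
    isHead zero _ = σ (suc k) , subst (V (σ (suc k))) τ₁₊ₖ≡τ₀ (proj₁ (steps k (ℕ.n<1+n k)))
    isHead (suc j) 1+j<1+k = σ (suc j) , proj₁ (steps j (ℕ.<-trans (ℕ.n<1+n j) 1+j<1+k))

    descent : ∀ j → j ℕ.< suc k → φ (τ (suc j)) ≺ φ (τ j)
    descent j j<1+k with steps j j<1+k
    ... | V-σ-τ , σ⊆τ , ¬V = descends (proj₂ (isHead j j<1+k)) V-σ-τ σ⊆τ ¬V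

    below-τ₀ : ∀ j → j ℕ.< suc k → φ (τ (suc j)) ≺ φ (τ 0)
    below-τ₀ zero 0<1+k = descent 0 0<1+k
    below-τ₀ (suc j) 1+j<1+k =
      ≺-trans (descent (suc j) 1+j<1+k) (below-τ₀ j (ℕ.<-trans (ℕ.n<1+n j) 1+j<1+k))

lower upper : ∀ {N} → Subset N → Fin N → Simp N
lower ρ k = below ρ k , from ρ k
upper ρ k = upTo ρ k , from ρ k

module _ {N : ℕ} {ρ ρ' : Subset N} {k k' : Fin N} (k∈ρ : k ∈ ρ) (k'∈ρ' : k' ∈ ρ') where

  lower≢upper : lower ρ k ≢ upper ρ' k'
  lower≢upper eq with from≡from⇒k≡k' k∈ρ k'∈ρ' (cong proj₂ eq)
  ... | refl = k∉below ρ k (subst (k ∈_) (sym (cong proj₁ eq)) (k∈upTo ρ' k k'∈ρ'))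

  lower≡lower⇒upper≡upper : lower ρ k ≡ lower ρ' k' → upper ρ k ≡ upper ρ' k'
  lower≡lower⇒upper≡upper eq with from≡from⇒k≡k' k∈ρ k'∈ρ' (cong proj₂ eq)
  ... | refl = cong₂ _,_
    (⊆-antisym (upTo⊆upTo ρ ρ' k'∈ρ' (cong proj₁ eq)) (upTo⊆upTo ρ' ρ k∈ρ (sym (cong proj₁ eq))))
    (cong proj₂ eq)
    where
    upTo⊆upTo : ∀ ρ₁ ρ₂ → k ∈ ρ₂ → below ρ₁ k ≡ below ρ₂ k → upTo ρ₁ k ⊆ upTo ρ₂ k
    upTo⊆upTo ρ₁ ρ₂ k∈ρ₂ eq' =
      upTo-⊆ ρ₁ k (k∈upTo ρ₂ k k∈ρ₂) (below⊆upTo ρ₂ k ∘ subst (_ ∈_) eq')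

  upper≡upper⇒lower≡lower : upper ρ k ≡ upper ρ' k' → lower ρ k ≡ lower ρ' k'
  upper≡upper⇒lower≡lower eq with from≡from⇒k≡k' k∈ρ k'∈ρ' (cong proj₂ eq)
  ... | refl = begin
    lower ρ k                    ≡⟨ cong (_, from ρ k) (below≡upTo-k ρ k) ⟩
    map₁ (_- k) (upper ρ k)      ≡⟨ cong (map₁ (_- k)) eq ⟩
    map₁ (_- k) (upper ρ' k)     ≡⟨ cong (_, from ρ' k) (below≡upTo-k ρ' k) ⟨
    lower ρ' k                   ∎

⊂-lex : ℕ → StrictPartialOrder _ _ _
⊂-lex N = ×-strictPartialOrder (⊂-strictPartialOrder N) (⊂-strictPartialOrder N)

module _ {N : ℕ} (A B : Complex N) where
  open StrictPartialOrder (⊂-lex N) using () renaming (_<_ to _<ₗₑₓ_)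

  ⊆upTo⇒Pbar : ∀ {ρ k S} → (A ∩ᶜ B) ρ → k ∈ ρ → S ⊆ upTo ρ k → Pbar A B (S , from ρ k)
  ⊆upTo⇒Pbar {ρ} {k} ρ∈A∩B k∈ρ S⊆ =
    inj₂ (k , k∈from ρ k k∈ρ) , ρ , k , ρ∈A∩B , k∈ρ ,
    (λ _ x∈S → ∈-upTo⁻ ρ k (S⊆ x∈S)) , (λ _ → ∈-from⁻ ρ k)

  𝒱-isDiscreteVectorField : IsDiscreteVectorField (Xtilde A B) (𝒱 A B)
  𝒱-isDiscreteVectorField = pair , unique
    where
    pair : ∀ σ τ → 𝒱 A B σ τ →
      Xtilde A B σ × Xtilde A B τ × σ ⊆ˢ τ × sizeS τ ≡ suc (sizeS σ)
    pair _ _ (ρ , k , ρ∈A∩B , k∈ρ , refl , refl) =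
      inj₂ (inj₁ (⊆upTo⇒Pbar ρ∈A∩B k∈ρ (below⊆upTo ρ k))) ,
      inj₂ (inj₁ (⊆upTo⇒Pbar ρ∈A∩B k∈ρ id)) ,
      (below⊆upTo ρ k , id) ,
      cong (ℕ._+ ∣ from ρ k ∣) (∣upTo∣≡1+∣below∣ ρ k k∈ρ)

    unique : ∀ σ τ σ' τ' → 𝒱 A B σ τ → 𝒱 A B σ' τ' →
      (σ ≡ σ' ⊎ σ ≡ τ' ⊎ τ ≡ σ' ⊎ τ ≡ τ') → σ ≡ σ' × τ ≡ τ'
    unique _ _ _ _ (_ , _ , _ , k∈ρ , refl , refl) (_ , _ , _ , k'∈ρ' , refl , refl) = λ where
      (inj₁ σ≡σ') → σ≡σ' , lower≡lower⇒upper≡upper k∈ρ k'∈ρ' σ≡σ'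
      (inj₂ (inj₁ σ≡τ')) → ⊥-elim (lower≢upper k∈ρ k'∈ρ' σ≡τ')
      (inj₂ (inj₂ (inj₁ τ≡σ'))) → ⊥-elim (lower≢upper k'∈ρ' k∈ρ (sym τ≡σ'))
      (inj₂ (inj₂ (inj₂ τ≡τ'))) → upper≡upper⇒lower≡lower k∈ρ k'∈ρ' τ≡τ' , τ≡τ'

  𝒱-descends : ∀ {σ τ σ' τ'} → 𝒱 A B σ τ → 𝒱 A B σ' τ' → σ' ⊆ˢ τ → ¬ 𝒱 A B σ' τ →
    swap τ' <ₗₑₓ swap τ
  𝒱-descends (ρ , k , ρ∈A∩B , k∈ρ , refl , refl) (ρ' , _ , _ , k'∈ρ' , refl , refl) (S'⊆S , T'⊆T) ¬𝒱
    with ⊆⇒⊂⊎≡ T'⊆T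
  ... | inj₁ T'⊂T = inj₁ T'⊂T
  ... | inj₂ T'≡T with from≡from⇒k≡k' k'∈ρ' k∈ρ T'≡T
  ... | refl with ⊆⇒⊂⊎≡ (upTo-⊆ ρ' k (k∈upTo ρ k k∈ρ) S'⊆S)
  ...   | inj₁ S'⊂S = inj₂ (T'≡T , S'⊂S)
  ...   | inj₂ S'≡S = ⊥-elim (¬𝒱 (ρ , k , ρ∈A∩B , k∈ρ ,
            upper≡upper⇒lower≡lower k'∈ρ' k∈ρ (cong₂ _,_ S'≡S T'≡T) , refl))

theorem3p1 : (N : ℕ) (X A B : Complex N) →
    IsSimplicialComplex X → IsSubcomplex A X → IsSubcomplex B X → IsUnion X A B →
    IsGradientVectorField (Xtilde A B) (𝒱 A B)
theorem3p1 N X A B _ _ _ _ =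
  𝒱-isDiscreteVectorField A B ,
  descending⇒¬ClosedTrajectory (⊂-lex N) swap (𝒱-descends A B)
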